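{- Let $m$ be a positive integer. If $m\equiv 1$ or $2\pmod 4$, then the frequency $f(m)=0$, i.e. there is no matrix $M\in\mathcal{M}_0$ with $P(M)=m$.
   Context: $\mathcal{M}$ is the set of all two-line matrices $M=\begin{pmatrix} c_1 & \cdots & c_s\\ d_1 & \cdots & d_s\end{pmatrix}$ ($s\ge1$) with non-negative integer entries satisfying $c_s=0$, $d_s\ne0$, and $c_j=c_{j+1}+d_{j+1}$ for $1\le j\le s-1$; $\mathcal{M}_0$ is the subset of those with $d_1=0$. With $\ell(M)$ the sum of all entries and $N=\ell(M)-d_1$, $P(M)$ is the sum of the numbers $2\big(N-(d_2+\cdots+d_k)-(c_1+\cdots+c_{k-1})-i\big)-1$ over $k=1,\ldots,s-1$ and $i=0,\ldots,c_k-1$. The frequency $f(m)$ is the number of $M\in\mathcal{M}_0$ with $P(M)=m$. -}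

module Defs where

open import Data.Nat using (ℕ; zero; suc; _+_; _∸_; pred)
open import Data.Integer as ℤ using (ℤ; +_)
open import Data.Product using (_×_; _,_; proj₁; proj₂)
open import Data.List using (List; []; _∷_; length)
open import Data.Empty using (⊥)
open import Relation.Binary.PropositionalEquality using (_≡_; _≢_)

-- A two-line matrix is the list of its columns (c_j , d_j), j = 1 .. s.
Column : Set
Column = ℕ × ℕ

Matrix : Set
Matrix = List Column

InM : Matrix → Set
InM []                           = ⊥
InM ((c , d) ∷ [])               = (c ≡ 0) × (d ≢ 0)
InM ((c , d) ∷ (c' , d') ∷ rest) = (c ≡ c' + d') × InM ((c' , d') ∷ rest)

-- 0-based column access (default (0,0) outside the matrix; never used there).
col : Matrix → ℕ → Column
col []       _       = (0 , 0)
col (x ∷ xs) zero    = x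
col (x ∷ xs) (suc j) = col xs j

-- 1-based entries c_j, d_j (j ≥ 1).
cE : Matrix → ℕ → ℕ
cE M j = proj₁ (col M (pred j))

dE : Matrix → ℕ → ℕ
dE M j = proj₂ (col M (pred j))

InM₀ : Matrix → Set
InM₀ M = InM M × (dE M 1 ≡ 0)

ℓ : Matrix → ℕ
ℓ []            = 0
ℓ ((c , d) ∷ M) = c + d + ℓ M

Nval : Matrix → ℕ
Nval M = ℓ M ∸ dE M 1

Σ₁ : (ℕ → ℕ) → ℕ → ℕ
Σ₁ f zero    = 0
Σ₁ f (suc k) = Σ₁ f k + f (suc k)

Σ₁ℤ : (ℕ → ℤ) → ℕ → ℤ
Σ₁ℤ f zero    = + 0
Σ₁ℤ f (suc k) = Σ₁ℤ f k ℤ.+ f (suc k)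

Σ₀ℤ : (ℕ → ℤ) → ℕ → ℤ
Σ₀ℤ f zero    = + 0
Σ₀ℤ f (suc n) = Σ₀ℤ f n ℤ.+ f n

Dpre : Matrix → ℕ → ℕ
Dpre M k = Σ₁ (λ j → dE M (suc j)) (pred k)

Cpre : Matrix → ℕ → ℕ
Cpre M k = Σ₁ (cE M) (pred k)

-- P(M) = Σ_{k=1}^{s-1} Σ_{i=0}^{c_k - 1} ( 2 (N - (d_2+…+d_k) - (c_1+…+c_{k-1}) - i) - 1 ),
-- computed in ℤ so that no truncated subtraction occurs.
P : Matrix → ℤ
P M = Σ₁ℤ (λ k → Σ₀ℤ (λ i → (+ 2) ℤ.* (+ Nval M ℤ.- + Dpre M k ℤ.- + Cpre M k ℤ.- + i) ℤ.- + 1)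
                     (cE M k))
          (pred (length M))

module Submission where

-- Proof idea.  For a matrix M ∈ 𝓜 with s columns put T = c_1 + … + c_{s-1}
-- and Q = c_1² + … + c_{s-1}².  Then
--
--     P(M) = T² + 2Q.
--
-- Indeed, the defining relations c_j = c_{j+1} + d_{j+1} telescope to
-- d_2 + … + d_k + c_k = c_1 and (as c_s = 0) to N = c_1 + T; so the k-th inner
-- sum of P runs over c_k consecutive odd numbers starting at 2A - 1 with
-- A = c_k + T - (c_1 + … + c_{k-1}); it equals c_k (2A - c_k), and summing over k
-- gives T² + 2Q.  Since x² ≡ x (mod 2), Q ≡ T (mod 2), whence T² + 2Q is
-- ≡ 0 (T even) or ≡ 3 (T odd) modulo 4, never ≡ 1 or 2.

open import Defs
open import Data.Nat using (ℕ; _<_; _%_)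
open import Data.Integer using (+_)
open import Data.Sum using (_⊎_)
open import Data.Product using (∃; _×_)
open import Relation.Nullary using (¬_)
open import Relation.Binary.PropositionalEquality using (_≡_)

import Data.Nat as ℕ
open import Data.Empty using (⊥)
open import Data.Product using (_,_; proj₁)
open import Data.Sum using (inj₁; inj₂)
open import Data.List using ([]; _∷_; length)
open import Relation.Binary.PropositionalEquality
  using (refl; sym; trans; cong; cong₂; subst; module ≡-Reasoning)

Σ₁² : (ℕ → ℕ) → ℕ → ℕ
Σ₁² c = Σ₁ (λ k → c k ℕ.* c k)

module Summation where
  open import Data.Nat using (zero; suc; pred; _≤_)
  open import Data.Nat.Properties using (m≤n⇒m≤1+n; ≤-refl)
  open import Data.Integer using (ℤ; _+_; _-_; _*_)
  open import Data.Integer.Properties using (pos-*)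
  open import Data.Integer.Tactic.RingSolver using (solve-∀)
  open ≡-Reasoning

  Σ₁ℤ-cong : ∀ {f g : ℕ → ℤ} n → (∀ k → suc k ≤ n → f (suc k) ≡ g (suc k)) →
             Σ₁ℤ f n ≡ Σ₁ℤ g n
  Σ₁ℤ-cong zero    f≗g = refl
  Σ₁ℤ-cong (suc n) f≗g =
    cong₂ _+_ (Σ₁ℤ-cong n (λ k k<n → f≗g k (m≤n⇒m≤1+n k<n))) (f≗g n ≤-refl)

  odd-run-sum : ∀ (A : ℤ) c →
                Σ₀ℤ (λ i → + 2 * (A - + i) - + 1) c ≡ + c * (+ 2 * A - + c)
  odd-run-sum A zero    = refl
  odd-run-sum A (suc c) =
    trans (cong (_+ (+ 2 * (A - + c) - + 1)) (odd-run-sum A c)) (extend A (+ c))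
    where
    extend : ∀ A x → x * (+ 2 * A - x) + (+ 2 * (A - x) - + 1)
                     ≡ (+ 1 + x) * (+ 2 * A - (+ 1 + x))
    extend = solve-∀

  weighted-sum : ∀ (c : ℕ → ℕ) (T : ℤ) n →
    Σ₁ℤ (λ k → + c k * (+ c k + + 2 * (T - + Σ₁ c (pred k)))) n
      ≡ + Σ₁ c n * (+ 2 * T - + Σ₁ c n) + + 2 * + Σ₁² c n
  weighted-sum c T zero    = refl
  weighted-sum c T (suc n) = begin
    Σ₁ℤ term n + term (suc n)
      ≡⟨ cong (_+ term (suc n)) (weighted-sum c T n) ⟩
    S * (+ 2 * T - S) + + 2 * Q + x * (x + + 2 * (T - S))
      ≡⟨ extend S T Q x ⟩
    (S + x) * (+ 2 * T - (S + x)) + + 2 * (Q + x * x)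
      ≡⟨ cong (λ y → (S + x) * (+ 2 * T - (S + x)) + + 2 * (Q + y)) (sym (pos-* (c (suc n)) (c (suc n)))) ⟩
    + Σ₁ c (suc n) * (+ 2 * T - + Σ₁ c (suc n)) + + 2 * + Σ₁² c (suc n) ∎
    where
    term : ℕ → ℤ
    term k = + c k * (+ c k + + 2 * (T - + Σ₁ c (pred k)))
    S Q x : ℤ
    S = + Σ₁ c n
    Q = + Σ₁² c n
    x = + c (suc n)
    extend : ∀ S T Q x → S * (+ 2 * T - S) + + 2 * Q + x * (x + + 2 * (T - S))
                         ≡ (S + x) * (+ 2 * T - (S + x)) + + 2 * (Q + x * x)
    extend = solve-∀

module FirstRow where
  open import Data.Nat using (zero; suc; _+_; _∸_; s≤s)
  open import Data.Nat.Properties using (+-assoc; +-comm; +-identityʳ; m+n∸m≡n; ≤-trans; n≤1+n; m≤n⇒m≤1+n)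
  open import Data.Nat.Tactic.RingSolver using (solve-∀)
  open ≡-Reasoning

  column-relation : ∀ M j → InM M → suc j < length M →
                    cE M (suc j) ≡ cE M (suc (suc j)) + dE M (suc (suc j))
  column-relation (_ ∷ [])           j       _            (s≤s ())
  column-relation (_ ∷ _ ∷ _)        zero    (rel , _)    _         = rel
  column-relation (_ ∷ M@(_ ∷ _))    (suc j) (_ , M∈𝓜)   (s≤s j<s) = column-relation M j M∈𝓜 j<s

  first-row-telescopes : ∀ M → InM M → ∀ k → k < length M → Dpre M (suc k) + cE M (suc k) ≡ cE M 1
  first-row-telescopes M M∈𝓜 zero    _   = refl
  first-row-telescopes M M∈𝓜 (suc k) k<s = begin
    D + dE M (suc (suc k)) + cE M (suc (suc k))
      ≡⟨ +-assoc D _ _ ⟩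
    D + (dE M (suc (suc k)) + cE M (suc (suc k)))
      ≡⟨ cong (λ y → D + y) (trans (+-comm (dE M (suc (suc k))) _) (sym (column-relation M k M∈𝓜 k<s))) ⟩
    D + cE M (suc k)
      ≡⟨ first-row-telescopes M M∈𝓜 k (≤-trans (n≤1+n _) k<s) ⟩
    cE M 1 ∎
    where
    D : ℕ
    D = Dpre M (suc k)

  rowSum : Matrix → ℕ
  rowSum []            = 0
  rowSum ((c , _) ∷ M) = c + rowSum M

  -- ℓ(M) = d_1 + c_1 + (c_1 + … + c_s), because d_2 + … + d_s telescopes to c_1.
  entry-sum : ∀ c d M → InM ((c , d) ∷ M) → ℓ ((c , d) ∷ M) ≡ d + (c + rowSum ((c , d) ∷ M))
  entry-sum c d []               (refl , _)  = refl
  entry-sum c d ((c' , d') ∷ M)  (refl , M∈𝓜) = begin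
    c' + d' + d + ℓ ((c' , d') ∷ M)
      ≡⟨ cong (λ y → c' + d' + d + y) (entry-sum c' d' M M∈𝓜) ⟩
    c' + d' + d + (d' + (c' + (c' + rowSum M)))
      ≡⟨ regroup c' d' d (rowSum M) ⟩
    d + (c' + d' + (c' + d' + (c' + rowSum M))) ∎
    where
    regroup : ∀ a b e r → a + b + e + (b + (a + (a + r))) ≡ e + (a + b + (a + b + (a + r)))
    regroup = solve-∀

  N-value : ∀ c d M → InM ((c , d) ∷ M) → Nval ((c , d) ∷ M) ≡ c + rowSum ((c , d) ∷ M)
  N-value c d M M∈𝓜 = trans (cong (_∸ d) (entry-sum c d M M∈𝓜)) (m+n∸m≡n d _)

  Σ₁-cE-cons : ∀ x M n → Σ₁ (cE (x ∷ M)) (suc n) ≡ proj₁ x + Σ₁ (cE M) n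
  Σ₁-cE-cons x M zero    = +-comm 0 (proj₁ x)
  Σ₁-cE-cons x M (suc n) =
    trans (cong (_+ cE M (suc n)) (Σ₁-cE-cons x M n)) (+-assoc (proj₁ x) _ _)

  Σ₁-cE≡rowSum : ∀ M → Σ₁ (cE M) (length M) ≡ rowSum M
  Σ₁-cE≡rowSum []      = refl
  Σ₁-cE≡rowSum (x ∷ M) = trans (Σ₁-cE-cons x M (length M)) (cong (λ y → proj₁ x + y) (Σ₁-cE≡rowSum M))

  last-top-zero : ∀ M → InM M → cE M (length M) ≡ 0
  last-top-zero (_ ∷ [])          (c≡0 , _)  = c≡0
  last-top-zero (_ ∷ M@(_ ∷ _))   (_ , M∈𝓜) = last-top-zero M M∈𝓜

  rowSum-without-last : ∀ x M → InM (x ∷ M) → rowSum (x ∷ M) ≡ Σ₁ (cE (x ∷ M)) (length M)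
  rowSum-without-last x M x∷M∈𝓜 = begin
    rowSum (x ∷ M)
      ≡⟨ sym (Σ₁-cE≡rowSum (x ∷ M)) ⟩
    Σ₁ (cE (x ∷ M)) (length M) + cE (x ∷ M) (suc (length M))
      ≡⟨ cong (λ y → Σ₁ (cE (x ∷ M)) (length M) + y) (last-top-zero (x ∷ M) x∷M∈𝓜) ⟩
    Σ₁ (cE (x ∷ M)) (length M) + 0
      ≡⟨ +-identityʳ _ ⟩
    Σ₁ (cE (x ∷ M)) (length M) ∎

  N-decomposition : ∀ x M → InM (x ∷ M) → ∀ j → j < length M →
    Nval (x ∷ M) ≡ Dpre (x ∷ M) (suc j) + (cE (x ∷ M) (suc j) + Σ₁ (cE (x ∷ M)) (length M))
  N-decomposition (c , d) M x∷M∈𝓜 j j<s = begin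
    Nval ((c , d) ∷ M)
      ≡⟨ N-value c d M x∷M∈𝓜 ⟩
    c + rowSum ((c , d) ∷ M)
      ≡⟨ cong₂ _+_ (sym (first-row-telescopes ((c , d) ∷ M) x∷M∈𝓜 j (m≤n⇒m≤1+n j<s)))
                   (rowSum-without-last (c , d) M x∷M∈𝓜) ⟩
    Dpre ((c , d) ∷ M) (suc j) + cE ((c , d) ∷ M) (suc j) + T
      ≡⟨ +-assoc (Dpre ((c , d) ∷ M) (suc j)) _ _ ⟩
    Dpre ((c , d) ∷ M) (suc j) + (cE ((c , d) ∷ M) (suc j) + T) ∎
    where
    T : ℕ
    T = Σ₁ (cE ((c , d) ∷ M)) (length M)

module ClosedForm where
  open import Data.Nat using (suc; pred; _≤_)
  open import Data.Integer using (_+_; _-_; _*_)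
  open import Data.Integer.Properties using (pos-*)
  open import Data.Integer.Tactic.RingSolver using (solve-∀)
  open ≡-Reasoning
  open Summation
  open FirstRow using (N-decomposition)

  rowTotal rowSquares : Matrix → ℕ
  rowTotal   M = Σ₁  (cE M) (pred (length M))
  rowSquares M = Σ₁² (cE M) (pred (length M))

  P-closed-form : ∀ M → InM M → P M ≡ + (rowTotal M ℕ.* rowTotal M ℕ.+ 2 ℕ.* rowSquares M)
  P-closed-form (x ∷ M) x∷M∈𝓜 = begin
    P (x ∷ M)
      ≡⟨ Σ₁ℤ-cong (length M) column-term ⟩
    Σ₁ℤ (λ k → + c k * (+ c k + + 2 * (+ T - + Σ₁ c (pred k)))) (length M)
      ≡⟨ weighted-sum c (+ T) (length M) ⟩
    + T * (+ 2 * + T - + T) + + 2 * + Q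
      ≡⟨ simplify (+ T) (+ Q) ⟩
    + T * + T + + 2 * + Q
      ≡⟨ cong₂ _+_ (sym (pos-* T T)) (sym (pos-* 2 Q)) ⟩
    + (T ℕ.* T ℕ.+ 2 ℕ.* Q) ∎
    where
    c : ℕ → ℕ
    c = cE (x ∷ M)
    T Q : ℕ
    T = Σ₁ c (length M)
    Q = Σ₁² c (length M)

    simplify : ∀ t q → t * (+ 2 * t - t) + + 2 * q ≡ t * t + + 2 * q
    simplify = solve-∀

    -- With N = D + (c_k + T), the inner sum of column k has A = c_k + T - C.
    cancel-D : ∀ D ck T C → ck * (+ 2 * (D + (ck + T) - D - C) - ck) ≡ ck * (ck + + 2 * (T - C))
    cancel-D = solve-∀

    column-term : ∀ j → suc j ≤ length M →
      Σ₀ℤ (λ i → + 2 * (+ Nval (x ∷ M) - + Dpre (x ∷ M) (suc j) - + Cpre (x ∷ M) (suc j) - + i) - + 1) (c (suc j))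
        ≡ + c (suc j) * (+ c (suc j) + + 2 * (+ T - + Σ₁ c j))
    column-term j j<s = begin
      _ ≡⟨ odd-run-sum (+ Nval (x ∷ M) - + D - + C) ck ⟩
      + ck * (+ 2 * (+ Nval (x ∷ M) - + D - + C) - + ck)
        ≡⟨ cong (λ n → + ck * (+ 2 * (+ n - + D - + C) - + ck)) (N-decomposition x M x∷M∈𝓜 j j<s) ⟩
      + ck * (+ 2 * (+ D + (+ ck + + T) - + D - + C) - + ck)
        ≡⟨ cancel-D (+ D) (+ ck) (+ T) (+ C) ⟩
      + ck * (+ ck + + 2 * (+ T - + C)) ∎
      where
      ck D C : ℕ
      ck = c (suc j)
      D  = Dpre (x ∷ M) (suc j)
      C  = Cpre (x ∷ M) (suc j)

module Residues where
  open import Data.Nat using (zero; suc; _+_; _*_)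
  open import Data.Nat.Properties using (+-suc)
  open import Data.Nat.Divisibility using (_∣_; divides; ∣m∣n⇒∣m+n; ∣m+n∣m⇒∣n; n∣m*n; n∣m⇒m%n≡0)
  open import Data.Nat.DivMod using (%-distribˡ-+)
  open import Data.Nat.Tactic.RingSolver using (solve-∀)
  open ≡-Reasoning

  square-plus-self-even : ∀ x → 2 ∣ x * x + x
  square-plus-self-even zero    = divides 0 refl
  square-plus-self-even (suc x) =
    subst (2 ∣_) (sym (step x)) (∣m∣n⇒∣m+n (square-plus-self-even x) (n∣m*n (suc x)))
    where
    step : ∀ x → suc x * suc x + suc x ≡ x * x + x + suc x * 2
    step = solve-∀

  squares-plus-sum-even : ∀ c n → 2 ∣ Σ₁² c n + Σ₁ c n
  squares-plus-sum-even c zero    = divides 0 refl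
  squares-plus-sum-even c (suc n) =
    subst (2 ∣_) (sym (regroup (Σ₁² c n) (Σ₁ c n) (c (suc n))))
          (∣m∣n⇒∣m+n (squares-plus-sum-even c n) (square-plus-self-even (c (suc n))))
    where
    regroup : ∀ q s x → q + x * x + (s + x) ≡ q + s + (x * x + x)
    regroup = solve-∀

  parity : ∀ n → (∃ λ b → n ≡ 2 * b) ⊎ (∃ λ b → n ≡ suc (2 * b))
  parity zero    = inj₁ (0 , refl)
  parity (suc n) with parity n
  ... | inj₁ (b , refl) = inj₂ (b , refl)
  ... | inj₂ (b , refl) = inj₁ (suc b , cong suc (sym (+-suc b (b + 0))))

  residue-0-or-3 : ∀ T q → 2 ∣ q + T → 4 ∣ T * T + 2 * q ⊎ 4 ∣ suc (T * T + 2 * q)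
  residue-0-or-3 T q (divides a q+T≡2a) with parity T
  ... | inj₁ (b , refl) = inj₁ (∣m+n∣m⇒∣n (divides (b * b + a) even-case) (n∣m*n b))
    where
    even-case : b * 4 + (2 * b * (2 * b) + 2 * q) ≡ (b * b + a) * 4
    even-case = begin
      b * 4 + (2 * b * (2 * b) + 2 * q)   ≡⟨ expand b q ⟩
      (b * b) * 4 + 2 * (q + 2 * b)       ≡⟨ cong (λ y → (b * b) * 4 + 2 * y) q+T≡2a ⟩
      (b * b) * 4 + 2 * (a * 2)           ≡⟨ collect b a ⟩
      (b * b + a) * 4 ∎
      where
      expand : ∀ b q → b * 4 + (2 * b * (2 * b) + 2 * q) ≡ (b * b) * 4 + 2 * (q + 2 * b)
      expand = solve-∀
      collect : ∀ b a → (b * b) * 4 + 2 * (a * 2) ≡ (b * b + a) * 4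
      collect = solve-∀
  ... | inj₂ (b , refl) = inj₂ (divides (b * b + a) odd-case)
    where
    odd-case : suc (suc (2 * b) * suc (2 * b) + 2 * q) ≡ (b * b + a) * 4
    odd-case = begin
      suc (suc (2 * b) * suc (2 * b) + 2 * q)   ≡⟨ expand b q ⟩
      (b * b) * 4 + 2 * (q + suc (2 * b))       ≡⟨ cong (λ y → (b * b) * 4 + 2 * y) q+T≡2a ⟩
      (b * b) * 4 + 2 * (a * 2)                 ≡⟨ collect b a ⟩
      (b * b + a) * 4 ∎
      where
      expand : ∀ b q → suc (suc (2 * b) * suc (2 * b) + 2 * q) ≡ (b * b) * 4 + 2 * (q + suc (2 * b))
      expand = solve-∀
      collect : ∀ b a → (b * b) * 4 + 2 * (a * 2) ≡ (b * b + a) * 4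
      collect = solve-∀

  residue-1-or-2-excluded : ∀ m → m % 4 ≡ 1 ⊎ m % 4 ≡ 2 → ¬ (4 ∣ m ⊎ 4 ∣ suc m)
  residue-1-or-2-excluded m residue divisible = excluded residue (residues divisible)
    where
    residues : 4 ∣ m ⊎ 4 ∣ suc m → m % 4 ≡ 0 ⊎ (1 + m % 4) % 4 ≡ 0
    residues (inj₁ 4∣m)   = inj₁ (n∣m⇒m%n≡0 m 4 4∣m)
    residues (inj₂ 4∣1+m) = inj₂ (trans (sym (%-distribˡ-+ 1 m 4)) (n∣m⇒m%n≡0 (suc m) 4 4∣1+m))

    excluded : ∀ {r} → r ≡ 1 ⊎ r ≡ 2 → r ≡ 0 ⊎ (1 + r) % 4 ≡ 0 → ⊥
    excluded (inj₁ refl) (inj₁ ())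
    excluded (inj₁ refl) (inj₂ ())
    excluded (inj₂ refl) (inj₁ ())
    excluded (inj₂ refl) (inj₂ ())

open import Data.Nat.Divisibility using (_∣_)
open import Data.Integer.Properties using (+-injective)
open ClosedForm using (rowTotal; rowSquares; P-closed-form)
open Residues using (squares-plus-sum-even; residue-0-or-3; residue-1-or-2-excluded)

corollary4p3 : (m : ℕ) → 0 < m → (m % 4 ≡ 1 ⊎ m % 4 ≡ 2) →
    ¬ (∃ λ (M : Matrix) → InM₀ M × P M ≡ + m)
corollary4p3 m _ residue ([] , (() , _) , _)
corollary4p3 m _ residue (M , (M∈𝓜 , _) , P≡m) =
  residue-1-or-2-excluded m residue
    (subst (λ n → 4 ∣ n ⊎ 4 ∣ ℕ.suc n) T²+2Q≡m
      (residue-0-or-3 T Q (squares-plus-sum-even (cE M) (ℕ.pred (length M)))))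
  where
  T Q : ℕ
  T = rowTotal M
  Q = rowSquares M
  T²+2Q≡m : T ℕ.* T ℕ.+ 2 ℕ.* Q ≡ m
  T²+2Q≡m = +-injective (trans (sym (P-closed-form M M∈𝓜)) P≡m)
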